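{- Define finite words over $\{a,b\}$ by $w_1=aabaabaab$ and, for $k>1$, $w_k=w_{k-1}\,a^{2^k}ba^{2^k}ba^{2^k}b$. Then the infinite word $w=\lim_{k\to\infty}w_k$ is abelian-square-rich but not uniformly abelian-square-rich.
   Context: An abelian square is a nonempty word $uv$ where $v$ is an anagram of $u$. For a finite word $v$, $\mathrm{AS}(v)$ is the number of distinct factors of $v$ that are abelian squares; $p_w(n)$ is the number of distinct factors of length $n$ of $w$. The word $w$ is abelian-square-rich if there exist $C>0$ and $n_0$ such that for all $n\ge n_0$, $\frac{1}{p_w(n)}\sum_{v \text{ factor of } w,\,|v|=n}\mathrm{AS}(v)\ge Cn^2$; uniformly abelian-square-rich if there exist $C>0$ and $n_0$ with $\mathrm{AS}(v)\ge C|v|^2$ for all factors $v$ of $w$ with $|v|\ge n_0$. -}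

module Defs where

open import Data.Nat using (ℕ; zero; suc; _+_; _*_; _^_; _≤_; _/_; _%_; _≡ᵇ_)
open import Data.Bool using (Bool; true; false; _∧_; if_then_else_)
open import Data.List using (List; []; _∷_; _++_; length; replicate; take; drop;
  concatMap; map; upTo; applyUpTo; deduplicate)
open import Data.Nat.ListAction using (sum)
open import Data.List.Properties using (≡-dec)
open import Data.List.Membership.Propositional using (_∈_)
open import Data.List.Relation.Unary.Unique.Propositional using (Unique)
open import Data.Maybe using (Maybe; just; nothing; fromMaybe)
open import Data.Product using (Σ; ∃; _×_; _,_)
open import Function.Bundles using (_⇔_)
open import Relation.Binary.PropositionalEquality using (_≡_; refl)
open import Relation.Binary.Definitions using (DecidableEquality)
open import Relation.Nullary using (yes; no)

data Letter : Set where
  a b : Letter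

_≟L_ : DecidableEquality Letter
a ≟L a = yes refl
a ≟L b = no (λ ())
b ≟L a = no (λ ())
b ≟L b = yes refl

Word : Set
Word = List Letter

_≟W_ : DecidableEquality Word
_≟W_ = ≡-dec _≟L_

count : Letter → Word → ℕ
count x []       = 0
count x (y ∷ ys) with x ≟L y
... | yes _ = suc (count x ys)
... | no  _ = count x ys

anagram : Word → Word → Bool
anagram u v = (count a u ≡ᵇ count a v) ∧ (count b u ≡ᵇ count b v)

-- x is an abelian square: x = u v, u nonempty, v an anagram of u.
-- (An anagram has the same length, so u is the first half of x.)
isAbSq : Word → Bool
isAbSq [] = false
isAbSq x@(_ ∷ _) =
  if (length x % 2) ≡ᵇ 0
  then anagram (take (length x / 2) x) (drop (length x / 2) x)
  else false

allFactors : Word → List Word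
allFactors v =
  concatMap (λ i → map (λ j → take j (drop i v)) (upTo (suc (length v))))
            (upTo (suc (length v)))

countTrue : (Word → Bool) → List Word → ℕ
countTrue p []       = 0
countTrue p (x ∷ xs) = if p x then suc (countTrue p xs) else countTrue p xs

AS : Word → ℕ
AS v = countTrue isAbSq (deduplicate _≟W_ (allFactors v))

block : ℕ → Word
block k = replicate (2 ^ k) a ++ (b ∷ [])

-- W k = w_(k+1) :  w_1 = aabaabaab,  w_k = w_(k-1) (a^(2^k) b)^3.
W : ℕ → Word
W zero    = a ∷ a ∷ b ∷ a ∷ a ∷ b ∷ a ∷ a ∷ b ∷ []
W (suc k) = W k ++ block (2 + k) ++ block (2 + k) ++ block (2 + k)

nth : Word → ℕ → Maybe Letter
nth []       _       = nothing
nth (x ∷ xs) zero    = just x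
nth (x ∷ xs) (suc n) = nth xs n

-- The limit word: letter n of w is letter n of w_(n+1) (which has length > n,
-- and each w_k is a prefix of w_(k+1)); the default is never used.
w : ℕ → Letter
w n = fromMaybe a (nth (W n) n)

slice : (ℕ → Letter) → ℕ → ℕ → Word
slice u i n = applyUpTo (λ j → u (i + j)) n

IsFactor : (ℕ → Letter) → Word → Set
IsFactor u v = ∃ λ i → v ≡ slice u i (length v)

-- L is a duplicate-free enumeration of the factors of u of length n;
-- then p_u(n) = length L.
EnumFactors : (ℕ → Letter) → ℕ → List Word → Set
EnumFactors u n L = Unique L × (∀ v → (v ∈ L) ⇔ (length v ≡ n × IsFactor u v))

-- Abelian-square-rich, with C = (suc c)/(suc d) > 0 rational:
-- for n ≥ n0,  (1/p_u(n)) Σ_{|v|=n factor} AS(v) ≥ C n².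
ASRich : (ℕ → Letter) → Set
ASRich u = ∃ λ c → ∃ λ d → ∃ λ n0 → ∀ n → n0 ≤ n → ∀ L → EnumFactors u n L →
  suc c * (n * n) * length L ≤ suc d * sum (map AS L)

UniformASRich : (ℕ → Letter) → Set
UniformASRich u = ∃ λ c → ∃ λ d → ∃ λ n0 → ∀ v → IsFactor u v → n0 ≤ length v →
  suc c * (length v * length v) ≤ suc d * AS v

module Submission where

-- Not uniform.  Every power a^M with M = 2^(k+2) is a factor of w, and all
-- factors of a^M are powers of a, so AS(a^M) ≤ M + 1 cannot be Ω(M²).
--
-- Given n ≥ 19 choose k with 4m + 3 ≤ n ≤ 8m + 6, where m = 2^(k+2) = 2h.
--   * Each of the m + 1 words  a^s b (a^m b a^m b a^m) ⋯  (s ≤ m) is a factor of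
--     length n of w, and each contains the (h + 1)² distinct abelian squares
--     a^(2i) b a^(2h) b a^(2j)  (i, j ≤ h); so Σ AS(v) ≥ (m + 1)(h + 1)².
--   * Past the prefix w_(k+5), consecutive b's of w are more than n letters
--     apart, so a factor of length n starts inside that prefix or contains at
--     most one b; hence p_w(n) ≤ |w_(k+5)| + n + 1 = O(m).
--   Since n = Θ(m), these give Σ AS(v) ≥ C n² p_w(n) with C = 1/53248.

open import Defs
open import Data.Bool using (Bool; true; false; if_then_else_; _∧_)
open import Data.Empty using (⊥-elim)
open import Data.List
  using (List; []; _∷_; _++_; length; replicate; take; drop; map; upTo; applyUpTo; deduplicate)
open import Data.List.Membership.Propositional using (_∈_; lose; find)
open import Data.List.Membership.Propositional.Properties
  using (∈-map⁺; ∈-map⁻; ∈-concatMap⁺; ∈-concatMap⁻; ∈-deduplicate⁺; ∈-deduplicate⁻;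
         ∈-upTo⁺; ∈-upTo⁻; ∈-++⁺ˡ; ∈-++⁺ʳ)
open import Data.List.Properties
  using (++-assoc; ++-identityʳ; length-++; length-replicate; length-map; length-upTo;
         length-take; ∷-injectiveʳ; take++drop≡id; ++-monoid)
open import Data.List.Relation.Unary.All using (lookup)
open import Data.List.Relation.Unary.Any using (here; there)
open import Data.List.Relation.Unary.AllPairs using ([]; _∷_)
open import Data.List.Relation.Unary.Unique.Propositional using (Unique)
open import Data.List.Relation.Unary.Unique.DecPropositional.Properties _≟W_ using (deduplicate-!)
import Data.List.Relation.Unary.Unique.Propositional.Properties as Unique
open import Data.Maybe using (just; fromMaybe)
open import Data.Nat
open import Data.Nat.DivMod using (m≡m%n+[m/n]*n; [m+kn]%n≡m%n; m*n/n≡m; m%n<n; m<n*o⇒m/o<n)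
open import Data.Nat.ListAction using (sum)
open import Data.Nat.Properties
open import Data.Nat.Tactic.RingSolver using (solve-∀)
open import Algebra.Properties.CommutativeSemigroup +-commutativeSemigroup using (x∙yz≈y∙xz)
open import Data.Product using (_×_; _,_; proj₁; proj₂; ∃)
open import Data.Sum using (inj₁; inj₂)
open import Data.Unit using (⊤; tt)
open import Function using (_∘_)
open import Function.Bundles using (Equivalence)
open import Relation.Binary.PropositionalEquality
  using (_≡_; _≢_; refl; sym; trans; cong; cong₂; subst; subst₂; module ≡-Reasoning)
open import Relation.Nullary using (¬_; yes; no)
import Algebra.Solver.Monoid as MonoidSolver
open MonoidSolver (++-monoid Letter) using (_⊜_; _⊕_) renaming (solve to ++-solve; id to ε)

-- Sums over duplicate-free lists: the lower bound on Σ AS(v) compares a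
-- duplicate-free family of factors with the enumeration L, and the bound on
-- p_w(n) compares L with an explicit covering list.
module _ {A : Set} where

  remove : ∀ {x : A} (xs : List A) → x ∈ xs → List A
  remove (_ ∷ xs) (here _)  = xs
  remove (y ∷ xs) (there p) = y ∷ remove xs p

  sum-remove : (g : A → ℕ) {x : A} (xs : List A) (p : x ∈ xs) →
               sum (map g xs) ≡ g x + sum (map g (remove xs p))
  sum-remove g (y ∷ xs) (here refl) = refl
  sum-remove g {x} (y ∷ xs) (there p) = begin
    g y + sum (map g xs)                    ≡⟨ cong (g y +_) (sum-remove g xs p) ⟩
    g y + (g x + sum (map g (remove xs p))) ≡⟨ x∙yz≈y∙xz (g y) (g x) _ ⟩
    g x + (g y + sum (map g (remove xs p))) ∎
    where open ≡-Reasoning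

  ∈-remove : ∀ {x y : A} (xs : List A) (p : x ∈ xs) → y ∈ xs → y ≢ x → y ∈ remove xs p
  ∈-remove (z ∷ xs) (here refl) (here refl) y≢x = ⊥-elim (y≢x refl)
  ∈-remove (z ∷ xs) (here refl) (there q)   y≢x = q
  ∈-remove (z ∷ xs) (there p)   (here refl) y≢x = here refl
  ∈-remove (z ∷ xs) (there p)   (there q)   y≢x = there (∈-remove xs p q y≢x)

  -- If S has no duplicates and every member of S occurs in X, then the sum of
  -- g over S is at most its sum over X: each element of S uses up one entry of X.
  sum-⊆ : (g : A → ℕ) (S X : List A) → Unique S → (∀ {y} → y ∈ S → y ∈ X) →
          sum (map g S) ≤ sum (map g X)
  sum-⊆ g [] X _ _ = z≤n
  sum-⊆ g (x ∷ S) X (x∉S ∷ uniqueS) S⊆X =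
    ≤-trans (+-monoʳ-≤ (g x) (sum-⊆ g S (remove X x∈X) uniqueS S⊆X-x))
            (≤-reflexive (sym (sum-remove g X x∈X)))
    where
    x∈X = S⊆X (here refl)
    S⊆X-x : ∀ {y} → y ∈ S → y ∈ remove X x∈X
    S⊆X-x q = ∈-remove X x∈X (S⊆X (there q)) (λ y≡x → lookup x∉S q (sym y≡x))

  length-⊆ : (S X : List A) → Unique S → (∀ {y} → y ∈ S → y ∈ X) → length S ≤ length X
  length-⊆ S X uniqueS S⊆X =
    subst₂ _≤_ (sum-ones S) (sum-ones X) (sum-⊆ (λ _ → 1) S X uniqueS S⊆X)
    where
    sum-ones : ∀ xs → sum (map (λ _ → 1) xs) ≡ length xs
    sum-ones []       = refl
    sum-ones (_ ∷ xs) = cong suc (sum-ones xs)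

  sum-≥ : (g : A → ℕ) (B : ℕ) (S : List A) → (∀ {y} → y ∈ S → B ≤ g y) →
          length S * B ≤ sum (map g S)
  sum-≥ g B []      _  = z≤n
  sum-≥ g B (x ∷ S) B≤ = +-mono-≤ (B≤ (here refl)) (sum-≥ g B S (λ q → B≤ (there q)))

  take-++ˡ : ∀ (v q : List A) → take (length v) (v ++ q) ≡ v
  take-++ˡ []      q = refl
  take-++ˡ (x ∷ v) q = cong (x ∷_) (take-++ˡ v q)

  drop-++ˡ : ∀ (p ys : List A) → drop (length p) (p ++ ys) ≡ ys
  drop-++ˡ []      ys = refl
  drop-++ˡ (_ ∷ p) ys = drop-++ˡ p ys

  drop-++-offset : ∀ (p ys : List A) t → drop (length p + t) (p ++ ys) ≡ drop t ys
  drop-++-offset []      ys t = refl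
  drop-++-offset (_ ∷ p) ys t = drop-++-offset p ys t

  replicate-++ : ∀ {x : A} m n → replicate (m + n) x ≡ replicate m x ++ replicate n x
  replicate-++ zero    n = refl
  replicate-++ (suc m) n = cong (_ ∷_) (replicate-++ m n)

  drop-replicate : ∀ {x : A} i M → drop i (replicate M x) ≡ replicate (M ∸ i) x
  drop-replicate zero    M       = refl
  drop-replicate (suc i) zero    = refl
  drop-replicate (suc i) (suc M) = drop-replicate i M

  take-replicate : ∀ {x : A} j M → take j (replicate M x) ≡ replicate (j ⊓ M) x
  take-replicate zero    M       = refl
  take-replicate (suc j) zero    = refl
  take-replicate (suc j) (suc M) = cong (_ ∷_) (take-replicate j M)

factorsFrom : Word → ℕ → List Word
factorsFrom v i = map (λ j → take j (drop i v)) (upTo (suc (length v)))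

allFactors-shape : ∀ {x} (v : Word) → x ∈ allFactors v → ∃ λ i → ∃ λ j → x ≡ take j (drop i v)
allFactors-shape {x} v x∈ with find (∈-concatMap⁻ (factorsFrom v) {xs = upTo (suc (length v))} x∈)
... | i , _ , x∈row with ∈-map⁻ (λ j → take j (drop i v)) {xs = upTo (suc (length v))} x∈row
...   | j , _ , x≡ = i , j , x≡

infix∈allFactors : ∀ (p x q v : Word) → v ≡ p ++ x ++ q → x ∈ allFactors v
infix∈allFactors p x q v v≡ =
  ∈-concatMap⁺ (factorsFrom v) (lose {P = λ i → x ∈ factorsFrom v i} (∈-upTo⁺ start<)
    (subst (_∈ factorsFrom v (length p)) takeDrop
      (∈-map⁺ (λ j → take j (drop (length p) v)) (∈-upTo⁺ len<))))
  where
  |v| : length v ≡ length p + (length x + length q)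
  |v| rewrite v≡ | length-++ p {x ++ q} | length-++ x {q} = refl
  start< : length p < suc (length v)
  start< rewrite |v| = s≤s (m≤m+n _ _)
  len< : length x < suc (length v)
  len< rewrite |v| = s≤s (≤-trans (m≤m+n (length x) (length q)) (m≤n+m _ (length p)))
  takeDrop : take (length x) (drop (length p) v) ≡ x
  takeDrop rewrite v≡ | drop-++ˡ p (x ++ q) = take-++ˡ x q

-- AS(v) counts the abelian squares among the distinct factors of v; as a sum of
-- 0/1 indicators it is monotone in the family of factors considered.
indicator : Bool → ℕ
indicator true  = 1
indicator false = 0

countTrue≡sum : ∀ (p : Word → Bool) X → countTrue p X ≡ sum (map (λ x → indicator (p x)) X)
countTrue≡sum p []      = refl
countTrue≡sum p (x ∷ X) with p x
... | true  = cong suc (countTrue≡sum p X)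
... | false = countTrue≡sum p X

countTrue≤length : ∀ (p : Word → Bool) X → countTrue p X ≤ length X
countTrue≤length p []      = z≤n
countTrue≤length p (x ∷ X) with p x
... | true  = s≤s (countTrue≤length p X)
... | false = m≤n⇒m≤1+n (countTrue≤length p X)

AS-≥ : ∀ (v : Word) S → Unique S → (∀ {y} → y ∈ S → isAbSq y ≡ true × y ∈ allFactors v) →
       length S ≤ AS v
AS-≥ v S uniqueS S⊆ = begin
  length S      ≡⟨ sym (sum-indicators S (λ q → proj₁ (S⊆ q))) ⟩
  sum (map g S) ≤⟨ sum-⊆ g S D uniqueS (λ q → ∈-deduplicate⁺ _≟W_ (proj₂ (S⊆ q))) ⟩
  sum (map g D) ≡⟨ sym (countTrue≡sum isAbSq D) ⟩
  AS v          ∎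
  where
  open ≤-Reasoning
  g = λ x → indicator (isAbSq x)
  D = deduplicate _≟W_ (allFactors v)
  sum-indicators : ∀ T → (∀ {y} → y ∈ T → isAbSq y ≡ true) → sum (map g T) ≡ length T
  sum-indicators []      _   = refl
  sum-indicators (x ∷ T) squares rewrite squares (here refl) =
    cong suc (sum-indicators T (λ q → squares (there q)))

-- The factors of a^M are a^0, …, a^M, so a^M contains at most M + 1 abelian squares.
AS-power : ∀ M → AS (replicate M a) ≤ suc M
AS-power M = begin
  AS v          ≤⟨ countTrue≤length isAbSq D ⟩
  length D      ≤⟨ length-⊆ D powers (deduplicate-! (allFactors v)) D⊆powers ⟩
  length powers ≡⟨ trans (length-map _ (upTo (suc M))) (length-upTo (suc M)) ⟩
  suc M         ∎
  where
  open ≤-Reasoning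
  v = replicate M a
  D = deduplicate _≟W_ (allFactors v)
  powers = map (λ j → replicate j a) (upTo (suc M))
  D⊆powers : ∀ {y} → y ∈ D → y ∈ powers
  D⊆powers q with allFactors-shape v (∈-deduplicate⁻ _≟W_ (allFactors v) q)
  ... | i , j , refl rewrite drop-replicate {x = a} i M | take-replicate {x = a} j (M ∸ i) =
    ∈-map⁺ (λ j → replicate j a) (∈-upTo⁺ (s≤s (≤-trans (m⊓n≤n j (M ∸ i)) (m∸n≤m M i))))

triple : ℕ → Word
triple k = block k ++ block k ++ block k

tail : ℕ → ℕ → Word
tail K zero    = []
tail K (suc j) = triple (2 + K) ++ tail (suc K) j

W-split : ∀ j K → W (j + K) ≡ W K ++ tail K j
W-split zero    K = sym (++-identityʳ (W K))
W-split (suc j) K = begin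
  W (suc (j + K))               ≡⟨ cong W (sym (+-suc j K)) ⟩
  W (j + suc K)                 ≡⟨ W-split j (suc K) ⟩
  W (suc K) ++ tail (suc K) j   ≡⟨ ++-assoc (W K) (triple (2 + K)) _ ⟩
  W K ++ tail K (suc j)         ∎
  where open ≡-Reasoning

length-block : ∀ k → length (block k) ≡ 2 ^ k + 1
length-block k = trans (length-++ (replicate (2 ^ k) a)) (cong (_+ 1) (length-replicate (2 ^ k)))

length-W-suc : ∀ k → length (W (suc k)) ≡ length (W k) + 3 * (2 ^ (2 + k) + 1)
length-W-suc k = begin
  length (W (suc k))                       ≡⟨ length-++ (W k) ⟩
  length (W k) + length (B ++ B ++ B)       ≡⟨ cong (length (W k) +_) length-BBB ⟩
  length (W k) + 3 * (2 ^ (2 + k) + 1)     ∎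
  where
  open ≡-Reasoning
  B = block (2 + k)
  length-BBB : length (B ++ B ++ B) ≡ 3 * (2 ^ (2 + k) + 1)
  length-BBB rewrite length-++ B {B ++ B} | length-++ B {B} | length-block (2 + k)
                   | +-identityʳ (2 ^ (2 + k) + 1) = refl

k<length-W : ∀ k → k < length (W k)
k<length-W zero    = s≤s z≤n
k<length-W (suc k) rewrite length-W-suc k =
  <-≤-trans (s≤s (k<length-W k))
    (≤-trans (≤-reflexive (+-comm 1 (length (W k))))
      (+-monoʳ-≤ (length (W k)) (≤-trans (m≤n+m 1 (2 ^ (2 + k))) (m≤m+n (2 ^ (2 + k) + 1) _))))

length-W≤ : ∀ k → length (W k) + 15 ≤ 24 * 2 ^ k
length-W≤ zero    = ≤-refl
length-W≤ (suc k) rewrite length-W-suc k = begin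
  x + 3 * (2 * (2 * P) + 1) + 15   ≡⟨ regroup x P ⟩
  (x + 15) + 12 * P + 3            ≤⟨ +-monoˡ-≤ 3 (+-monoˡ-≤ (12 * P) (length-W≤ k)) ⟩
  24 * P + 12 * P + 3              ≤⟨ +-monoʳ-≤ (24 * P + 12 * P) 3≤12P ⟩
  24 * P + 12 * P + 12 * P         ≡⟨ double P ⟩
  24 * (2 * P)                     ∎
  where
  open ≤-Reasoning
  x = length (W k)
  P = 2 ^ k
  regroup : ∀ x P → x + 3 * (2 * (2 * P) + 1) + 15 ≡ (x + 15) + 12 * P + 3
  regroup = solve-∀
  double : ∀ P → 24 * P + 12 * P + 12 * P ≡ 24 * (2 * P)
  double = solve-∀
  3≤12P : 3 ≤ 12 * P
  3≤12P = ≤-trans (s≤s (s≤s (s≤s z≤n))) (*-monoʳ-≤ 12 (m^n>0 2 k))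

nth-++ : ∀ (xs ys : Word) p → p < length xs → nth (xs ++ ys) p ≡ nth xs p
nth-++ (x ∷ xs) ys zero    _        = refl
nth-++ (x ∷ xs) ys (suc p) (s≤s lt) = nth-++ xs ys p lt

nth-just : ∀ (xs : Word) p → p < length xs → ∃ λ y → nth xs p ≡ just y
nth-just (x ∷ xs) zero    _        = x , refl
nth-just (x ∷ xs) (suc p) (s≤s lt) = nth-just xs p lt

nth-W-stable : ∀ k p → p < length (W k) → nth (W k) p ≡ nth (W p) p
nth-W-stable k p p<W with ≤-total k p
... | inj₁ k≤p = begin
  nth (W k) p                      ≡⟨ sym (nth-++ (W k) (tail k (p ∸ k)) p p<W) ⟩
  nth (W k ++ tail k (p ∸ k)) p    ≡⟨ cong (λ t → nth t p) (sym (W-split (p ∸ k) k)) ⟩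
  nth (W (p ∸ k + k)) p            ≡⟨ cong (λ t → nth (W t) p) (m∸n+n≡m k≤p) ⟩
  nth (W p) p                      ∎
  where open ≡-Reasoning
... | inj₂ p≤k = begin
  nth (W k) p                      ≡⟨ cong (λ t → nth (W t) p) (sym (m∸n+n≡m p≤k)) ⟩
  nth (W (k ∸ p + p)) p            ≡⟨ cong (λ t → nth t p) (W-split (k ∸ p) p) ⟩
  nth (W p ++ tail p (k ∸ p)) p    ≡⟨ nth-++ (W p) (tail p (k ∸ p)) p (k<length-W p) ⟩
  nth (W p) p                      ∎
  where open ≡-Reasoning

nth-W : ∀ k p → p < length (W k) → nth (W k) p ≡ just (w p)
nth-W k p p<W with nth-just (W p) p (k<length-W p)
... | y , nth≡ = trans (nth-W-stable k p p<W) (trans nth≡ (cong just (sym (cong (fromMaybe a) nth≡))))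

drop-nth : ∀ (xs : Word) i x → nth xs i ≡ just x → drop i xs ≡ x ∷ drop (suc i) xs
drop-nth (y ∷ xs) zero    x refl = refl
drop-nth (y ∷ xs) (suc i) x nth≡ = drop-nth xs i x nth≡

applyUpTo≡take : ∀ (f : ℕ → Letter) n i (xs : Word) →
  (∀ j → j < n → nth xs (i + j) ≡ just (f j)) → applyUpTo f n ≡ take n (drop i xs)
applyUpTo≡take f zero    i xs agree = refl
applyUpTo≡take f (suc n) i xs agree
  rewrite drop-nth xs i (f 0) (subst (λ t → nth xs t ≡ just (f 0)) (+-identityʳ i) (agree 0 (s≤s z≤n))) =
  cong (f 0 ∷_) (applyUpTo≡take (λ j → f (suc j)) n (suc i) xs
    (λ j j<n → trans (cong (nth xs) (sym (+-suc i j))) (agree (suc j) (s≤s j<n))))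

slice-W : ∀ k i n → i + n ≤ length (W k) → slice w i n ≡ take n (drop i (W k))
slice-W k i n inside = applyUpTo≡take (λ j → w (i + j)) n i (W k)
  (λ j j<n → nth-W k (i + j) (≤-trans (+-monoʳ-< i j<n) inside))

infix-factor : ∀ k (p v q : Word) → W k ≡ p ++ v ++ q → IsFactor w v
infix-factor k p v q W≡ = length p , sym (begin
  slice w (length p) (length v)             ≡⟨ slice-W k (length p) (length v) inside ⟩
  take (length v) (drop (length p) (W k))   ≡⟨ cong (take (length v) ∘ drop (length p)) W≡ ⟩
  take (length v) (drop (length p) (p ++ v ++ q)) ≡⟨ cong (take (length v)) (drop-++ˡ p (v ++ q)) ⟩
  take (length v) (v ++ q)                  ≡⟨ take-++ˡ v q ⟩
  v                                         ∎)
  where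
  open ≡-Reasoning
  inside : length p + length v ≤ length (W k)
  inside rewrite W≡ | length-++ p {v ++ q} | length-++ v {q} =
    +-monoʳ-≤ (length p) (m≤m+n (length v) (length q))

power-factor : ∀ K → IsFactor w (replicate (2 ^ (2 + K)) a)
power-factor K = infix-factor (suc K) (W K) (replicate (2 ^ (2 + K)) a) (b ∷ B ++ B)
  (cong (W K ++_) (++-assoc (replicate (2 ^ (2 + K)) a) (b ∷ []) (B ++ B)))
  where
  B = block (2 + K)

n<2^n : ∀ n → n < 2 ^ n
n<2^n zero    = s≤s z≤n
n<2^n (suc n) = begin-strict
  suc n            ≤⟨ n<2^n n ⟩
  2 ^ n            <⟨ m<m+n (2 ^ n) (m^n>0 2 n) ⟩
  2 ^ n + 2 ^ n    ≡⟨ cong (2 ^ n +_) (sym (+-identityʳ (2 ^ n))) ⟩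
  2 * 2 ^ n        ∎
  where open ≤-Reasoning

linear<square : ∀ d M → d + 3 ≤ M → suc d * suc M < M * M
linear<square d M d+3≤M = begin-strict
  suc d * suc M        ≡⟨ expand d M ⟩
  suc d * M + suc d    <⟨ +-monoʳ-< (suc d * M) d+1<2M ⟩
  suc d * M + 2 * M    ≡⟨ collect d M ⟩
  (d + 3) * M          ≤⟨ *-monoˡ-≤ M d+3≤M ⟩
  M * M                ∎
  where
  open ≤-Reasoning
  expand : ∀ d M → suc d * suc M ≡ suc d * M + suc d
  expand = solve-∀
  collect : ∀ d M → suc d * M + 2 * M ≡ (d + 3) * M
  collect = solve-∀
  d+1<2M : suc d < 2 * M
  d+1<2M = ≤-trans (≤-trans (n≤1+n (2 + d)) (≤-reflexive (+-comm 3 d))) (≤-trans d+3≤M (m≤m+n M (M + 0)))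

notUniform : ¬ UniformASRich w
notUniform (c , d , n0 , uniform) = <⇒≱ (linear<square d M d+3≤M) (begin
  M * M                          ≤⟨ m≤n*m (M * M) (suc c) ⟩
  suc c * (M * M)                ≡⟨ cong (λ t → suc c * (t * t)) (sym |v|) ⟩
  suc c * (length v * length v)  ≤⟨ uniform v (power-factor K) n0≤|v| ⟩
  suc d * AS v                   ≤⟨ *-monoʳ-≤ (suc d) (AS-power M) ⟩
  suc d * suc M                  ∎)
  where
  open ≤-Reasoning
  K = n0 + d + 1
  M = 2 ^ (2 + K)
  v = replicate M a
  |v| : length v ≡ M
  |v| = length-replicate M
  2+K≤M : 2 + K ≤ M
  2+K≤M = <⇒≤ (n<2^n (2 + K))
  d+3≤M : d + 3 ≤ M
  d+3≤M = ≤-trans (m≤n+m (d + 3) n0) (≤-trans (≤-reflexive (regroup d n0)) 2+K≤M)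
    where
    regroup : ∀ d n0 → n0 + (d + 3) ≡ 2 + (n0 + d + 1)
    regroup = solve-∀
  n0≤|v| : n0 ≤ length v
  n0≤|v| rewrite |v| = ≤-trans (≤-trans (m≤m+n n0 (d + 1)) (≤-reflexive (sym (+-assoc n0 d 1))))
                                (≤-trans (m≤n+m K 2) 2+K≤M)

-- Gapped N r xs says: reading xs after a run of r letters
-- a, every b is preceded by at least N letters a since the previous b (or the
-- start).  The tails of w are Gapped with N = 2^(K+2), so their short factors
-- contain at most one b.

Gapped : ℕ → ℕ → Word → Set
Gapped N r []       = ⊤
Gapped N r (a ∷ xs) = Gapped N (suc r) xs
Gapped N r (b ∷ xs) = N ≤ r × Gapped N 0 xs

Gapped-saturate : ∀ N r r' xs → N ≤ r' → Gapped N r xs → Gapped N r' xs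
Gapped-saturate N r r' []       _    _       = tt
Gapped-saturate N r r' (a ∷ xs) N≤r' g       = Gapped-saturate N (suc r) (suc r') xs (m≤n⇒m≤1+n N≤r') g
Gapped-saturate N r r' (b ∷ xs) N≤r' (_ , g) = N≤r' , g

Gapped-drop : ∀ N r i xs → Gapped N r xs → Gapped N N (drop i xs)
Gapped-drop N r zero    xs       g       = Gapped-saturate N r N xs ≤-refl g
Gapped-drop N r (suc i) []       g       = tt
Gapped-drop N r (suc i) (a ∷ xs) g       = Gapped-drop N (suc r) i xs g
Gapped-drop N r (suc i) (b ∷ xs) (_ , g) = Gapped-drop N 0 i xs g

Gapped-take : ∀ N r n xs → Gapped N r xs → Gapped N r (take n xs)
Gapped-take N r zero    xs       g       = tt
Gapped-take N r (suc n) []       g       = tt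
Gapped-take N r (suc n) (a ∷ xs) g       = Gapped-take N (suc r) n xs g
Gapped-take N r (suc n) (b ∷ xs) (h , g) = h , Gapped-take N 0 n xs g

Gapped-no-b : ∀ N r xs → Gapped N r xs → r + length xs ≤ N → count b xs ≡ 0
Gapped-no-b N r []       g       _ = refl
Gapped-no-b N r (a ∷ xs) g       short =
  Gapped-no-b N (suc r) xs g (≤-trans (≤-reflexive (sym (+-suc r (length xs)))) short)
Gapped-no-b N r (b ∷ xs) (N≤r , _) short =
  ⊥-elim (<-irrefl refl (<-≤-trans (m<m+n r (s≤s z≤n)) (≤-trans short N≤r)))

-- A Gapped word of length ≤ N + 1 contains at most one b: after a b, fewer
-- than N letters remain.
Gapped-one-b : ∀ N r xs → Gapped N r xs → length xs ≤ suc N → count b xs ≤ 1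
Gapped-one-b N r []       g       _           = z≤n
Gapped-one-b N r (a ∷ xs) g       (s≤s short) = Gapped-one-b N (suc r) xs g (m≤n⇒m≤1+n short)
Gapped-one-b N r (b ∷ xs) (_ , g) (s≤s short) rewrite Gapped-no-b N 0 xs g short = s≤s z≤n

Gapped-power++ : ∀ N r M ys → Gapped N (r + M) ys → Gapped N r (replicate M a ++ ys)
Gapped-power++ N r zero    ys g = subst (λ t → Gapped N t ys) (+-identityʳ r) g
Gapped-power++ N r (suc M) ys g =
  Gapped-power++ N (suc r) M ys (subst (λ t → Gapped N t ys) (+-suc r M) g)

Gapped-block : ∀ N k r ys → N ≤ 2 ^ k → Gapped N 0 ys → Gapped N r (block k ++ ys)
Gapped-block N k r ys N≤ g rewrite ++-assoc (replicate (2 ^ k) a) (b ∷ []) ys =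
  Gapped-power++ N r (2 ^ k) (b ∷ ys) (≤-trans N≤ (m≤n+m (2 ^ k) r) , g)

Gapped-tail : ∀ N K j r → N ≤ 2 ^ (2 + K) → Gapped N r (tail K j)
Gapped-tail N K zero    r N≤ = tt
Gapped-tail N K (suc j) r N≤
  rewrite ++-assoc (block (2 + K)) (block (2 + K) ++ block (2 + K)) (tail (suc K) j)
        | ++-assoc (block (2 + K)) (block (2 + K)) (tail (suc K) j) =
  Gapped-block N (2 + K) r _ N≤ (Gapped-block N (2 + K) 0 _ N≤ (Gapped-block N (2 + K) 0 _ N≤
    (Gapped-tail N (suc K) j 0 (≤-trans N≤ (^-monoʳ-≤ 2 (n≤1+n (2 + K)))))))

oneBetween : ℕ → ℕ → Word
oneBetween x y = replicate x a ++ b ∷ replicate y a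

oneB : ℕ → ℕ → Word
oneB n x = oneBetween x (n ∸ suc x)

atMostOneB : ℕ → List Word
atMostOneB n = map (oneB n) (upTo n) ++ (replicate n a ∷ [])

count-b≡0 : ∀ v → count b v ≡ 0 → v ≡ replicate (length v) a
count-b≡0 []      _   = refl
count-b≡0 (a ∷ v) no-b = cong (a ∷_) (count-b≡0 v no-b)
count-b≡0 (b ∷ v) ()

count-b≡1 : ∀ v → count b v ≡ 1 → ∃ λ x → x < length v × v ≡ oneB (length v) x
count-b≡1 []      ()
count-b≡1 (a ∷ v) one-b with count-b≡1 v one-b
... | x , x< , v≡ = suc x , s≤s x< , cong (a ∷_) v≡
count-b≡1 (b ∷ v) one-b = 0 , s≤s z≤n , cong (b ∷_) (count-b≡0 v (suc-injective one-b))

∈atMostOneB : ∀ v → count b v ≤ 1 → v ∈ atMostOneB (length v)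
∈atMostOneB v ≤1 with count b v in eq
... | zero = ∈-++⁺ʳ (map (oneB (length v)) (upTo (length v))) (here (count-b≡0 v eq))
... | suc zero with count-b≡1 v eq
...   | x , x< , v≡ = ∈-++⁺ˡ (subst (_∈ map (oneB (length v)) (upTo (length v))) (sym v≡)
                               (∈-map⁺ (oneB (length v)) (∈-upTo⁺ x<)))
∈atMostOneB v (s≤s ()) | suc (suc _)

-- The factors of length n of w: those starting inside W K, and those with at most one b.
candidates : ℕ → ℕ → List Word
candidates K n = map (λ i → slice w i n) (upTo (length (W K))) ++ atMostOneB n

length-candidates : ∀ K n → length (candidates K n) ≡ length (W K) + (n + 1)
length-candidates K n
  rewrite length-++ (map (λ i → slice w i n) (upTo (length (W K)))) {atMostOneB n}
        | length-map (λ i → slice w i n) (upTo (length (W K))) | length-upTo (length (W K))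
        | length-++ (map (oneB n) (upTo n)) {replicate n a ∷ []} | length-map (oneB n) (upTo n)
        | length-upTo n = refl

-- A factor starting at i ≥ |W K| lies in a tail, which is Gapped with run 2^(K+2) ≥ n.
late-factor-one-b : ∀ K n i t → n ≤ 2 ^ (2 + K) → i ≡ length (W K) + t → count b (slice w i n) ≤ 1
late-factor-one-b K n i t n≤N i≡ =
  subst (λ v → count b v ≤ 1) (sym slice≡)
    (Gapped-one-b N N window gapped (≤-trans |window|≤n (m≤n⇒m≤1+n n≤N)))
  where
  N = 2 ^ (2 + K)
  J = i + n
  window = take n (drop t (tail K J))
  gapped : Gapped N N window
  gapped = Gapped-take N N n _ (Gapped-drop N 0 t (tail K J) (Gapped-tail N K J 0 ≤-refl))
  |window|≤n : length window ≤ n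
  |window|≤n = ≤-trans (≤-reflexive (length-take n _)) (m⊓n≤m n _)
  slice≡ : slice w i n ≡ window
  slice≡ = begin
    slice w i n                                         ≡⟨ slice-W (J + K) i n inside ⟩
    take n (drop i (W (J + K)))                         ≡⟨ cong (take n ∘ drop i) (W-split J K) ⟩
    take n (drop i (W K ++ tail K J))                   ≡⟨ cong (λ z → take n (drop z (W K ++ tail K J))) i≡ ⟩
    take n (drop (length (W K) + t) (W K ++ tail K J))  ≡⟨ cong (take n) (drop-++-offset (W K) (tail K J) t) ⟩
    window                                              ∎
    where
    open ≡-Reasoning
    inside : i + n ≤ length (W (J + K))
    inside = ≤-trans (m≤m+n J K) (<⇒≤ (k<length-W (J + K)))

factor∈candidates : ∀ K n → n ≤ 2 ^ (2 + K) → ∀ v → length v ≡ n → IsFactor w v → v ∈ candidates K n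
factor∈candidates K n n≤N v refl (i , v≡) with i <? length (W K)
... | yes early = ∈-++⁺ˡ (subst (_∈ map (λ i → slice w i n) (upTo (length (W K)))) (sym v≡)
                          (∈-map⁺ (λ i → slice w i n) (∈-upTo⁺ early)))
... | no late = ∈-++⁺ʳ (map (λ i → slice w i n) (upTo (length (W K))))
                  (∈atMostOneB v (subst (λ u → count b u ≤ 1) (sym v≡)
                    (late-factor-one-b K n i (i ∸ length (W K)) n≤N (sym (m+[n∸m]≡n (≮⇒≥ late))))))

complexity≤ : ∀ K n L → n ≤ 2 ^ (2 + K) → EnumFactors w n L → length L ≤ length (W K) + (n + 1)
complexity≤ K n L n≤N (uniqueL , L⇔) =
  ≤-trans (length-⊆ L (candidates K n) uniqueL
            (λ {v} v∈L → let |v|≡n , factor = Equivalence.to (L⇔ v) v∈L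
                         in factor∈candidates K n n≤N v |v|≡n factor))
          (≤-reflexive (length-candidates K n))

-- For m = 2h, the factors
-- a^(2i) b a^(2h) b a^(2j) with i, j ≤ h are abelian squares (split
-- a^(2h) into a^(h-i+j) a^(h-j+i)), and they are pairwise distinct.

≡ᵇ-refl : ∀ n → (n ≡ᵇ n) ≡ true
≡ᵇ-refl zero    = refl
≡ᵇ-refl (suc n) = ≡ᵇ-refl n

isAbSq-++ : ∀ (u v : Word) → 0 < length u → length u ≡ length v →
            count a u ≡ count a v → count b u ≡ count b v → isAbSq (u ++ v) ≡ true
isAbSq-++ u@(_ ∷ _) v _ |u|≡|v| #a≡ #b≡ = begin
  isAbSq (u ++ v)
    ≡⟨ cong (λ e → if e then anagram (take H (u ++ v)) (drop H (u ++ v)) else false) even ⟩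
  anagram (take H (u ++ v)) (drop H (u ++ v))
    ≡⟨ cong (λ z → anagram (take z (u ++ v)) (drop z (u ++ v))) half ⟩
  anagram (take (length u) (u ++ v)) (drop (length u) (u ++ v))
    ≡⟨ cong₂ anagram (take-++ˡ u v) (drop-++ˡ u v) ⟩
  anagram u v
    ≡⟨ cong₂ _∧_ (trans (cong (_≡ᵇ count a v) #a≡) (≡ᵇ-refl (count a v)))
                 (trans (cong (_≡ᵇ count b v) #b≡) (≡ᵇ-refl (count b v))) ⟩
  true ∎
  where
  open ≡-Reasoning
  L = length u
  H = length (u ++ v) / 2
  |uv| : length (u ++ v) ≡ L * 2
  |uv| = trans (length-++ u) (trans (cong (L +_) (sym |u|≡|v|)) (twice L))
    where
    twice : ∀ L → L + L ≡ L * 2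
    twice = solve-∀
  even : (length (u ++ v) % 2 ≡ᵇ 0) ≡ true
  even = subst (λ z → (z % 2 ≡ᵇ 0) ≡ true) (sym |uv|) (cong (_≡ᵇ 0) ([m+kn]%n≡m%n 0 L 2))
  half : H ≡ L
  half = trans (cong (_/ 2) |uv|) (m*n/n≡m L 2)

count-++ : ∀ c (xs ys : Word) → count c (xs ++ ys) ≡ count c xs + count c ys
count-++ c []       ys = refl
count-++ c (x ∷ xs) ys with c ≟L x
... | yes _ = cong suc (count-++ c xs ys)
... | no  _ = count-++ c xs ys

count-a-power : ∀ n → count a (replicate n a) ≡ n
count-a-power zero    = refl
count-a-power (suc n) = cong suc (count-a-power n)

count-b-power : ∀ n → count b (replicate n a) ≡ 0
count-b-power zero    = refl
count-b-power (suc n) = count-b-power n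

length-oneBetween : ∀ x y → length (oneBetween x y) ≡ x + suc y
length-oneBetween x y
  rewrite length-++ (replicate x a) {b ∷ replicate y a} | length-replicate x {a}
        | length-replicate y {a} = refl

count-a-oneBetween : ∀ x y → count a (oneBetween x y) ≡ x + y
count-a-oneBetween x y
  rewrite count-++ a (replicate x a) (b ∷ replicate y a) | count-a-power x | count-a-power y = refl

count-b-oneBetween : ∀ x y → count b (oneBetween x y) ≡ 1
count-b-oneBetween x y
  rewrite count-++ b (replicate x a) (b ∷ replicate y a) | count-b-power x | count-b-power y = refl

isAbSq-oneBetween² : ∀ x y y' q → x + y ≡ y' + q → isAbSq (oneBetween x y ++ oneBetween y' q) ≡ true
isAbSq-oneBetween² x y y' q balanced = isAbSq-++ u v nonempty sameLength sameA sameB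
  where
  u = oneBetween x y
  v = oneBetween y' q
  nonempty : 0 < length u
  nonempty rewrite length-oneBetween x y | +-suc x y = s≤s z≤n
  sameLength : length u ≡ length v
  sameLength rewrite length-oneBetween x y | length-oneBetween y' q | +-suc x y | +-suc y' q =
    cong suc balanced
  sameA : count a u ≡ count a v
  sameA rewrite count-a-oneBetween x y | count-a-oneBetween y' q = balanced
  sameB : count b u ≡ count b v
  sameB rewrite count-b-oneBetween x y | count-b-oneBetween y' q = refl

twoBs : ℕ → ℕ → ℕ → Word
twoBs x m q = replicate x a ++ b ∷ replicate m a ++ b ∷ replicate q a

-- a^(2i) b a^(2h) b a^(2j) = (a^(2i) b a^(h-i+j)) (a^(h-j+i) b a^(2j)) with balanced halves.
isAbSq-twoBs : ∀ h i j → i ≤ h → j ≤ h → isAbSq (twoBs (2 * i) (2 * h) (2 * j)) ≡ true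
isAbSq-twoBs h i j i≤h j≤h =
  subst (λ z → isAbSq z ≡ true) (sym split) (isAbSq-oneBetween² (2 * i) y y' (2 * j) balanced)
  where
  y  = (h ∸ i) + j
  y' = (h ∸ j) + i
  hi : (h ∸ i) + i ≡ h
  hi = m∸n+n≡m i≤h
  hj : (h ∸ j) + j ≡ h
  hj = m∸n+n≡m j≤h
  balanced : 2 * i + y ≡ y' + 2 * j
  balanced = begin
    2 * i + ((h ∸ i) + j)    ≡⟨ regroupˡ (h ∸ i) i j ⟩
    ((h ∸ i) + i) + i + j    ≡⟨ cong (λ z → z + i + j) (trans hi (sym hj)) ⟩
    ((h ∸ j) + j) + i + j    ≡⟨ regroupʳ (h ∸ j) i j ⟩
    ((h ∸ j) + i) + 2 * j    ∎
    where
    open ≡-Reasoning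
    regroupˡ : ∀ X i j → 2 * i + (X + j) ≡ (X + i) + i + j
    regroupˡ = solve-∀
    regroupʳ : ∀ Y i j → (Y + j) + i + j ≡ (Y + i) + 2 * j
    regroupʳ = solve-∀
  2h≡y+y' : 2 * h ≡ y + y'
  2h≡y+y' = trans (cong₂ (λ p q → p + (q + 0)) (sym hi) (sym hj)) (regroup (h ∸ i) (h ∸ j) i j)
    where
    regroup : ∀ X Y i j → (X + i) + ((Y + j) + 0) ≡ (X + j) + (Y + i)
    regroup = solve-∀
  split : twoBs (2 * i) (2 * h) (2 * j) ≡ oneBetween (2 * i) y ++ oneBetween y' (2 * j)
  split = trans (cong (λ r → replicate (2 * i) a ++ b ∷ r ++ b ∷ replicate (2 * j) a)
                      (trans (cong (λ t → replicate t a) 2h≡y+y') (replicate-++ y y')))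
    (++-solve 5 (λ P β Y Y' Q → P ⊕ β ⊕ (Y ⊕ Y') ⊕ β ⊕ Q ⊜ (P ⊕ β ⊕ Y) ⊕ (Y' ⊕ β ⊕ Q)) refl
      (replicate (2 * i) a) (b ∷ []) (replicate y a) (replicate y' a) (replicate (2 * j) a))

core : ℕ → Word
core m = replicate m a ++ b ∷ replicate m a ++ b ∷ replicate m a

twoBs-in-core : ∀ h i j → i ≤ h → j ≤ h →
  core (2 * h) ≡ replicate (2 * h ∸ 2 * i) a ++ twoBs (2 * i) (2 * h) (2 * j) ++ replicate (2 * h ∸ 2 * j) a
twoBs-in-core h i j i≤h j≤h = trans (cong₂ (λ p q → p ++ b ∷ M ++ b ∷ q) leftRun rightRun)
  (++-solve 6 (λ A P β M Q D → (A ⊕ P) ⊕ β ⊕ M ⊕ β ⊕ (Q ⊕ D) ⊜ A ⊕ (P ⊕ β ⊕ M ⊕ β ⊕ Q) ⊕ D) refl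
    L (replicate (2 * i) a) (b ∷ []) M (replicate (2 * j) a) R)
  where
  M = replicate (2 * h) a
  L = replicate (2 * h ∸ 2 * i) a
  R = replicate (2 * h ∸ 2 * j) a
  leftRun : M ≡ L ++ replicate (2 * i) a
  leftRun = trans (cong (λ t → replicate t a) (sym (m∸n+n≡m (*-monoʳ-≤ 2 i≤h))))
                  (replicate-++ (2 * h ∸ 2 * i) (2 * i))
  rightRun : M ≡ replicate (2 * j) a ++ R
  rightRun = trans (cong (λ t → replicate t a) (sym (m+[n∸m]≡n (*-monoʳ-≤ 2 j≤h))))
                   (replicate-++ (2 * j) (2 * h ∸ 2 * j))

power-b-injective : ∀ x x' u u' → replicate x a ++ b ∷ u ≡ replicate x' a ++ b ∷ u' → x ≡ x' × u ≡ u'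
power-b-injective zero    zero     u u' eq = refl , ∷-injectiveʳ eq
power-b-injective zero    (suc x') u u' ()
power-b-injective (suc x) zero     u u' ()
power-b-injective (suc x) (suc x') u u' eq with power-b-injective x x' u u' (∷-injectiveʳ eq)
... | x≡x' , u≡u' = cong suc x≡x' , u≡u'

twoBs-injective : ∀ m x q x' q' → twoBs x m q ≡ twoBs x' m q' → x ≡ x' × q ≡ q'
twoBs-injective m x q x' q' eq with power-b-injective x x' _ _ eq
... | x≡x' , rest≡ with power-b-injective m m _ _ rest≡
...   | _ , run≡ = x≡x' , trans (sym (length-replicate q)) (trans (cong length run≡) (length-replicate q'))

-- Coding the pairs (i, j) with i, j ≤ h by k < (h+1)² through division by h + 1.
squareNo : ℕ → ℕ → Word
squareNo h k = twoBs (2 * (k / suc h)) (2 * h) (2 * (k % suc h))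

squareNo-injective : ∀ h {k k'} → squareNo h k ≡ squareNo h k' → k ≡ k'
squareNo-injective h {k} {k'} eq
  with twoBs-injective (2 * h) (2 * (k / suc h)) (2 * (k % suc h)) (2 * (k' / suc h)) (2 * (k' % suc h)) eq
... | quot≡ , rem≡ = begin
  k                                   ≡⟨ m≡m%n+[m/n]*n k (suc h) ⟩
  k % suc h + (k / suc h) * suc h     ≡⟨ cong₂ (λ r q → r + q * suc h)
                                              (*-cancelˡ-≡ (k % suc h) (k' % suc h) 2 rem≡)
                                              (*-cancelˡ-≡ (k / suc h) (k' / suc h) 2 quot≡) ⟩
  k' % suc h + (k' / suc h) * suc h   ≡⟨ sym (m≡m%n+[m/n]*n k' (suc h)) ⟩
  k'                                  ∎
  where open ≡-Reasoning

AS-core : ∀ h (f P Q : Word) → f ≡ P ++ core (2 * h) ++ Q → suc h * suc h ≤ AS f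
AS-core h f P Q f≡ = ≤-trans (≤-reflexive (sym |S|)) (AS-≥ f S uniqueS squares)
  where
  H = suc h
  S = map (squareNo h) (upTo (H * H))
  |S| : length S ≡ H * H
  |S| = trans (length-map (squareNo h) (upTo (H * H))) (length-upTo (H * H))
  uniqueS : Unique S
  uniqueS = Unique.map⁺ (squareNo-injective h) (Unique.upTo⁺ (H * H))
  squares : ∀ {y} → y ∈ S → isAbSq y ≡ true × y ∈ allFactors f
  squares y∈S with ∈-map⁻ (squareNo h) y∈S
  ... | k , k∈ , refl =
    isAbSq-twoBs h i j i≤h j≤h , infix∈allFactors (P ++ A) (squareNo h k) (D ++ Q) f f≡'
    where
    i = k / H
    j = k % H
    i≤h : i ≤ h
    i≤h = ≤-pred (m<n*o⇒m/o<n (∈-upTo⁻ k∈))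
    j≤h : j ≤ h
    j≤h = ≤-pred (m%n<n k H)
    A = replicate (2 * h ∸ 2 * i) a
    D = replicate (2 * h ∸ 2 * j) a
    f≡' : f ≡ (P ++ A) ++ squareNo h k ++ (D ++ Q)
    f≡' = trans f≡ (trans (cong (λ c → P ++ c ++ Q) (twoBs-in-core h i j i≤h j≤h))
      (++-solve 5 (λ P A Z D Q → P ⊕ (A ⊕ Z ⊕ D) ⊕ Q ⊜ (P ⊕ A) ⊕ Z ⊕ (D ⊕ Q))
        refl P A (squareNo h k) D Q))

-- Fix k and n with 4m + 3 ≤ n ≤ 8m + 6, where m = 2^(k+2)
-- = 2h.  Inside W (k+2) = W k (a^m b)^3 (a^(2m) b)^3, for each s ≤ m the word
-- a^s b · a^m b a^m b a^m · (a prefix of what follows) is a factor of length n.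
module RichFactors (k n : ℕ) where

  h m : ℕ
  h = 2 ^ (1 + k)
  m = 2 ^ (2 + k)

  -- What follows the three-run core in W (k+2) when it starts at a block boundary.
  after : Word
  after = replicate m a ++ b ∷ block (3 + k) ++ block (3 + k)

  padding : ℕ → ℕ
  padding s = n ∸ (s + 3 * m + 3)

  member : ℕ → Word
  member s = replicate s a ++ b ∷ (core m ++ take (padding s) after)

  -- Splitting the first run a^m of the second triple as a^(m-s) a^s.
  W-around-core : ∀ s → s ≤ m →
    W (2 + k) ≡ (W k ++ replicate (m ∸ s) a) ++ (replicate s a ++ b ∷ (core m ++ after)) ++ []
  W-around-core s s≤m =
    trans (cong₂ unfolded m-split 2m-split) (trans regroup (cong refolded (sym m-split)))
    where
    A₁ = replicate (m ∸ s) a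
    A₂ = replicate s a
    Q = block (3 + k)
    unfolded : Word → Word → Word
    unfolded X Y = (W k ++ ((X ++ b ∷ []) ++ (X ++ b ∷ []) ++ (X ++ b ∷ [])))
                   ++ ((Y ++ b ∷ []) ++ Q ++ Q)
    refolded : Word → Word
    refolded X = (W k ++ A₁) ++ (A₂ ++ b ∷ ((X ++ b ∷ X ++ b ∷ X) ++ (X ++ b ∷ Q ++ Q))) ++ []
    m-split : replicate m a ≡ A₁ ++ A₂
    m-split = trans (cong (λ t → replicate t a) (sym (m∸n+n≡m s≤m))) (replicate-++ (m ∸ s) s)
    2m-split : replicate (2 * m) a ≡ (A₁ ++ A₂) ++ (A₁ ++ A₂)
    2m-split = trans (replicate-++ m (m + 0))
                     (cong₂ _++_ m-split (trans (cong (λ t → replicate t a) (+-identityʳ m)) m-split))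
    regroup : unfolded (A₁ ++ A₂) ((A₁ ++ A₂) ++ (A₁ ++ A₂)) ≡ refolded (A₁ ++ A₂)
    regroup = ++-solve 5 (λ P A₁ A₂ β Q →
        (P ⊕ (((A₁ ⊕ A₂) ⊕ β) ⊕ ((A₁ ⊕ A₂) ⊕ β) ⊕ ((A₁ ⊕ A₂) ⊕ β)))
          ⊕ ((((A₁ ⊕ A₂) ⊕ (A₁ ⊕ A₂)) ⊕ β) ⊕ Q ⊕ Q)
      ⊜ (P ⊕ A₁)
          ⊕ (A₂ ⊕ β ⊕ (((A₁ ⊕ A₂) ⊕ β ⊕ (A₁ ⊕ A₂) ⊕ β ⊕ (A₁ ⊕ A₂)) ⊕ ((A₁ ⊕ A₂) ⊕ β ⊕ Q ⊕ Q)))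
          ⊕ ε)
      refl (W k) A₁ A₂ (b ∷ []) Q

  member-factor : ∀ s → s ≤ m → IsFactor w (member s)
  member-factor s s≤m = infix-factor (2 + k) before (member s) (rest ++ [])
    (trans (W-around-core s s≤m)
      (trans (cong (λ z → before ++ (replicate s a ++ b ∷ (core m ++ z)) ++ [])
                   (sym (take++drop≡id (padding s) after)))
        (++-solve 6 (λ P A β C T D → P ⊕ (A ⊕ β ⊕ (C ⊕ (T ⊕ D))) ⊕ ε ⊜ P ⊕ (A ⊕ β ⊕ (C ⊕ T)) ⊕ (D ⊕ ε))
          refl before (replicate s a) (b ∷ []) (core m) (take (padding s) after) rest)))
    where
    before = W k ++ replicate (m ∸ s) a
    rest = drop (padding s) after

  length-core : length (core m) ≡ 3 * m + 2
  length-core rewrite length-++ (replicate m a) {b ∷ replicate m a ++ b ∷ replicate m a}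
                    | length-++ (replicate m a) {b ∷ replicate m a} | length-replicate m {a} = count-runs m
    where
    count-runs : ∀ m → m + suc (m + suc m) ≡ 3 * m + 2
    count-runs = solve-∀

  length-after : length after ≡ 5 * m + 3
  length-after rewrite length-++ (replicate m a) {b ∷ block (3 + k) ++ block (3 + k)}
                     | length-++ (block (3 + k)) {block (3 + k)} | length-block (3 + k)
                     | length-replicate m {a} = count-runs m
    where
    count-runs : ∀ m → m + suc (2 * m + 1 + (2 * m + 1)) ≡ 5 * m + 3
    count-runs = solve-∀

  module _ (lower : 4 * m + 3 ≤ n) (upper : n ≤ 8 * m + 6) where

    used≤n : ∀ s → s ≤ m → s + 3 * m + 3 ≤ n
    used≤n s s≤m = ≤-trans (+-monoˡ-≤ 3 (+-monoˡ-≤ (3 * m) s≤m)) (≤-trans (≤-reflexive (4m+3 m)) lower)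
      where
      4m+3 : ∀ m → m + 3 * m + 3 ≡ 4 * m + 3
      4m+3 = solve-∀

    length-padding : ∀ s → length (take (padding s) after) ≡ padding s
    length-padding s = trans (length-take (padding s) after) (m≤n⇒m⊓n≡m padding≤)
      where
      used = s + 3 * m + 3
      8m+6 : ∀ s m → s + 3 * m + 3 + (5 * m + 3) ≡ s + (8 * m + 6)
      8m+6 = solve-∀
      n≤used+after : n ≤ used + (5 * m + 3)
      n≤used+after = ≤-trans upper (≤-trans (m≤n+m (8 * m + 6) s) (≤-reflexive (sym (8m+6 s m))))
      padding≤ : padding s ≤ length after
      padding≤ = ≤-trans (∸-monoˡ-≤ used n≤used+after)
                         (≤-reflexive (trans (m+n∸m≡n used (5 * m + 3)) (sym length-after)))

    length-member : ∀ s → s ≤ m → length (member s) ≡ n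
    length-member s s≤m = begin
      length (member s)
        ≡⟨ length-++ (replicate s a) ⟩
      length (replicate s a) + suc (length (core m ++ take (padding s) after))
        ≡⟨ cong₂ (λ x y → x + suc y) (length-replicate s) (length-++ (core m)) ⟩
      s + suc (length (core m) + length (take (padding s) after))
        ≡⟨ cong₂ (λ x y → s + suc (x + y)) length-core (length-padding s) ⟩
      s + suc ((3 * m + 2) + padding s)
        ≡⟨ regroup s m (padding s) ⟩
      padding s + (s + 3 * m + 3)
        ≡⟨ m∸n+n≡m (used≤n s s≤m) ⟩
      n ∎
      where
      open ≡-Reasoning
      regroup : ∀ s m r → s + suc ((3 * m + 2) + r) ≡ r + (s + 3 * m + 3)
      regroup = solve-∀

    -- The m + 1 members are distinct factors of length n, each with at least
    -- (h + 1)² abelian squares.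
    sumAS≥ : ∀ L → EnumFactors w n L → suc m * (suc h * suc h) ≤ sum (map AS L)
    sumAS≥ L (_ , L⇔) = begin
      suc m * B          ≡⟨ cong (_* B) (sym |F|) ⟩
      length F * B       ≤⟨ sum-≥ AS B F many-squares ⟩
      sum (map AS F)     ≤⟨ sum-⊆ AS F L uniqueF F⊆L ⟩
      sum (map AS L)     ∎
      where
      open ≤-Reasoning
      B = suc h * suc h
      F = map member (upTo (suc m))
      |F| : length F ≡ suc m
      |F| = trans (length-map member (upTo (suc m))) (length-upTo (suc m))
      uniqueF : Unique F
      uniqueF = Unique.map⁺ (λ eq → proj₁ (power-b-injective _ _ _ _ eq)) (Unique.upTo⁺ (suc m))
      many-squares : ∀ {y} → y ∈ F → B ≤ AS y
      many-squares y∈F with ∈-map⁻ member {xs = upTo (suc m)} y∈F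
      ... | s , _ , refl = AS-core h (member s) (replicate s a ++ b ∷ []) (take (padding s) after)
                             (sym (++-assoc (replicate s a) (b ∷ []) (core m ++ take (padding s) after)))
      F⊆L : ∀ {y} → y ∈ F → y ∈ L
      F⊆L y∈F with ∈-map⁻ member {xs = upTo (suc m)} y∈F
      ... | s , s∈ , refl =
        Equivalence.from (L⇔ (member s)) (length-member s s≤m , member-factor s s≤m)
        where
        s≤m : s ≤ m
        s≤m = ≤-pred (∈-upTo⁻ s∈)

-- Choosing the scale: every n ≥ 19 lies in a window 4m + 3 ≤ n ≤ 8m + 6 with
-- m = 2^(k+2); search downwards from a k whose window lies above n.
window-below : ∀ j n → 19 ≤ n → n ≤ 8 * 2 ^ (2 + j) + 6 →
               ∃ λ k → 4 * 2 ^ (2 + k) + 3 ≤ n × n ≤ 8 * 2 ^ (2 + k) + 6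
window-below zero    n lower upper = 0 , lower , upper
window-below (suc j) n lower upper with 4 * 2 ^ (2 + suc j) + 3 ≤? n
... | yes above = suc j , above , upper
... | no below  = window-below j n lower (≤-trans n≤ (+-monoʳ-≤ (8 * 2 ^ (2 + j)) (s≤s (s≤s z≤n))))
  where
  same : ∀ P → 4 * (2 * P) + 2 ≡ 8 * P + 2
  same = solve-∀
  n≤ : n ≤ 8 * 2 ^ (2 + j) + 2
  n≤ = ≤-pred (≤-trans (≰⇒> below)
                (≤-reflexive (trans (+-suc (4 * 2 ^ (2 + suc j)) 2) (cong suc (same (2 ^ (2 + j)))))))

window : ∀ n → 19 ≤ n → ∃ λ k → 4 * 2 ^ (2 + k) + 3 ≤ n × n ≤ 8 * 2 ^ (2 + k) + 6
window n lower = window-below n n lower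
  (≤-trans (≤-trans (m≤n+m n 2) (<⇒≤ (n<2^n (2 + n))))
           (≤-trans (m≤n*m (2 ^ (2 + n)) 8) (m≤m+n _ 6)))

module Window (k n : ℕ) (upper : n ≤ 8 * 2 ^ (2 + k) + 6) where

  h H : ℕ
  h = 2 ^ (1 + k)
  H = suc h

  n≤16H : n ≤ 16 * H
  n≤16H = ≤-trans upper (≤-trans (m≤m+n (8 * (2 * h) + 6) 10) (≤-reflexive (regroup h)))
    where
    regroup : ∀ h → 8 * (2 * h) + 6 + 10 ≡ 16 * suc h
    regroup = solve-∀

  complexity≤208H : ∀ L → EnumFactors w n L → length L ≤ 208 * H
  complexity≤208H L enum = begin
    length L                                             ≤⟨ complexity≤ (4 + k) n L n≤2^[6+k] enum ⟩
    length (W (4 + k)) + (n + 1)                         ≤⟨ +-mono-≤ |W| (+-monoˡ-≤ 1 upper) ⟩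
    24 * (2 * (2 * (2 * h))) + (8 * (2 * h) + 6 + 1)      ≤⟨ m≤m+n _ 201 ⟩
    24 * (2 * (2 * (2 * h))) + (8 * (2 * h) + 6 + 1) + 201 ≡⟨ regroup h ⟩
    208 * H                                              ∎
    where
    open ≤-Reasoning
    regroup : ∀ h → 24 * (2 * (2 * (2 * h))) + (8 * (2 * h) + 6 + 1) + 201 ≡ 208 * suc h
    regroup = solve-∀
    32h : ∀ h → 8 * (2 * h) + 16 * h ≡ 2 * (2 * (2 * (2 * (2 * h))))
    32h = solve-∀
    6≤16h : 6 ≤ 16 * h
    6≤16h = ≤-trans (s≤s (s≤s (s≤s (s≤s (s≤s (s≤s z≤n)))))) (*-monoʳ-≤ 16 (m^n>0 2 (1 + k)))
    n≤2^[6+k] : n ≤ 2 ^ (2 + (4 + k))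
    n≤2^[6+k] = ≤-trans upper (≤-trans (+-monoʳ-≤ (8 * (2 * h)) 6≤16h) (≤-reflexive (32h h)))
    |W| : length (W (4 + k)) ≤ 24 * (2 * (2 * (2 * h)))
    |W| = ≤-trans (m≤m+n _ 15) (length-W≤ (4 + k))

-- w is abelian-square-rich with C = 1/53248 = 1/(16 · 16 · 208): in the window,
-- n² p_w(n) ≤ (16H)²(208H) while Σ AS(v) ≥ (2h + 1) H² ≥ H³.
rich : ASRich w
rich = 0 , 53247 , 19 , λ n 19≤n L enum →
  let k , lower , upper = window n 19≤n in bound k n lower upper L enum
  where
  bound : ∀ k n → 4 * 2 ^ (2 + k) + 3 ≤ n → n ≤ 8 * 2 ^ (2 + k) + 6 → ∀ L → EnumFactors w n L →
          1 * (n * n) * length L ≤ 53248 * sum (map AS L)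
  bound k n lower upper L enum = begin
    1 * (n * n) * length L                ≡⟨ cong (_* length L) (*-identityˡ (n * n)) ⟩
    n * n * length L                      ≤⟨ *-mono-≤ (*-mono-≤ n≤16H n≤16H) (complexity≤208H L enum) ⟩
    (16 * H) * (16 * H) * (208 * H)       ≡⟨ cube 16 16 208 H ⟩
    53248 * (H * (H * H))                 ≤⟨ *-monoʳ-≤ 53248 (*-monoˡ-≤ (H * H) (s≤s (m≤m+n h (h + 0)))) ⟩
    53248 * (suc (2 * h) * (H * H))       ≤⟨ *-monoʳ-≤ 53248 (RichFactors.sumAS≥ k n lower upper L enum) ⟩
    53248 * sum (map AS L)                ∎
    where
    open ≤-Reasoning
    open Window k n upper
    cube : ∀ c₁ c₂ c₃ H → (c₁ * H) * (c₂ * H) * (c₃ * H) ≡ (c₁ * c₂ * c₃) * (H * (H * H))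
    cube = solve-∀

proposition5 : ASRich w × ¬ UniformASRich w
proposition5 = rich , notUniform
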